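{- Let $p<q$ be primes, $\xi=\log q/\log p$, let $(a,b)$ be an upper or lower best approximation for $\xi$, and set $\alpha=p^a/q^b$. Then the map $\phi:\mathcal V(\alpha)\to\mathcal B(\alpha)$ given by $\phi(\mathbf x)=A_{\mathbf x}$ (its equivalence class) is a bijection.
   Context: $\mathbb N_0=\{0,1,2,\dots\}$, $\mathcal N=\{(a,b)\in\mathbb N_0^2:(a,b)\neq(0,0)\}$, $\mathcal G=\{(a,b)\in\mathcal N:\gcd(a,b)=1\}$ (convention $\gcd(a,0)=a$; $a/0=\infty$ for $a\in\mathbb N$). For positive irrational $\xi$: $\mathcal U(\xi)=\{(a,b)\in\mathcal N:a>b\xi\}$, $\mathcal L(\xi)=\{(a,b)\in\mathcal N:a<b\xi\}$, $\mathcal U_1(\xi)=\{(a,b)\in\mathcal U(\xi): a/b=\min\{m/n:(m,n)\in\mathcal U(\xi),\ m\le a\}\}$, $\mathcal L_2(\xi)=\{(a,b)\in\mathcal L(\xi): a/b=\max\{m/n:(m,n)\in\mathcal L(\xi),\ n\le b\}\}$; upper (resp. lower) best approximations for $\xi$ are elements of $\mathcal G\cap\mathcal U_1(\xi)$ (resp. $\mathcal G\cap\mathcal L_2(\xi)$). A factorization of a positive rational $\alpha\neq1$ is a tuple $(r_1/s_1,\dots,r_N/s_N)$ with product $\alpha$, $r_n,s_n\in\mathbb N$, $r_n/s_n\ne1$, $\gcd(r_m,s_n)=1$ for all $m,n$; for $\alpha=p^a/q^b$ these all have the form $(p^{a_1}/q^{b_1},\dots,p^{a_N}/q^{b_N})$.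 Two tuples are equivalent if they have the same length and differ by a permutation of entries. $\mathcal B(\alpha)$ denotes the set of equivalence classes of factorizations $(p^{a_1}/q^{b_1},\dots,p^{a_N}/q^{b_N})$ of $\alpha$ with every $(a_n,b_n)\in\mathcal G\cap(\mathcal U_1(\xi)\cup\mathcal L_2(\xi))$. Let $(a_1,b_1),\dots,(a_N,b_N)$ be the complete list of upper or lower best approximations to $\xi$ with $a_n\le a$ and $b_n\le b$, ordered so that $b_1\le\dots\le b_N$ and $a_n\le a_{n+1}$ whenever $b_n=b_{n+1}$. The characteristic transformation of $\alpha$ is the linear map $T_\alpha:\mathbb R^N\to\mathbb R^2$ with matrix having first row $(a_1,\dots,a_N)$ and second row $(b_1,\dots,b_N)$. $\mathcal V(\alpha)$ is the set of $\mathbf x=(x_1,\dots,x_N)^T$ with all $x_n\in\mathbb N_0$ and $T_\alpha(\mathbf x)=(a,b)^T$. For $\mathbf x\in\mathcal V(\alpha)$, $A_{\mathbf x}$ is the tuple consisting of $x_1$ copies of $p^{a_1}/q^{b_1}$, then $x_2$ copies of $p^{a_2}/q^{b_2}$, ..., then $x_N$ copies of $p^{a_N}/q^{b_N}$. -}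

module Defs where

open import Data.Nat using (ℕ; _+_; _*_; _^_; _≤_; _<_)
open import Data.Nat.GCD using (gcd)
open import Data.Nat.Coprimality using (Coprime)
open import Data.Product using (_×_; _,_; proj₁; proj₂)
open import Data.Sum using (_⊎_)
open import Data.List using (List; []; _∷_; _++_; replicate; length; map)
open import Data.Nat.ListAction using (product)
open import Data.List.Relation.Unary.All using (All)
open import Data.List.Relation.Unary.Unique.Propositional using (Unique)
open import Data.List.Relation.Unary.Linked using (Linked)
open import Data.List.Membership.Propositional using (_∈_)
open import Data.Vec using (Vec; []; _∷_)
open import Relation.Binary.PropositionalEquality using (_≡_)
open import Relation.Nullary using (¬_)

InN : ℕ × ℕ → Set
InN (a , b) = ¬ (a ≡ 0 × b ≡ 0)

-- 𝒢 : in 𝒩 and gcd a b = 1  (stdlib: gcd a 0 = a, matching the convention)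
InG : ℕ × ℕ → Set
InG (a , b) = InN (a , b) × gcd a b ≡ 1

-- a > b ξ  ⟺  p^a > q^b   (since log p > 0)
InU : (p q : ℕ) → ℕ × ℕ → Set
InU p q (a , b) = InN (a , b) × q ^ b < p ^ a

-- a < b ξ  ⟺  p^a < q^b
InL : (p q : ℕ) → ℕ × ℕ → Set
InL p q (a , b) = InN (a , b) × p ^ a < q ^ b

-- m/n ≤ c/d for (m,n),(c,d) ∈ 𝒩, with x/0 = ∞ : cross-multiplication
RatLe : ℕ × ℕ → ℕ × ℕ → Set
RatLe (m , n) (c , d) = m * d ≤ c * n

-- 𝒰₁(ξ): a/b = min { m/n : (m,n) ∈ 𝒰(ξ), m ≤ a }  ((a,b) itself belongs to that set)
InU1 : (p q : ℕ) → ℕ × ℕ → Set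
InU1 p q (a , b) = InU p q (a , b) ×
  (∀ m n → InU p q (m , n) → m ≤ a → RatLe (a , b) (m , n))

-- ℒ₂(ξ): a/b = max { m/n : (m,n) ∈ ℒ(ξ), n ≤ b }
InL2 : (p q : ℕ) → ℕ × ℕ → Set
InL2 p q (a , b) = InL p q (a , b) ×
  (∀ m n → InL p q (m , n) → n ≤ b → RatLe (m , n) (a , b))

BestApprox : (p q : ℕ) → ℕ × ℕ → Set
BestApprox p q e = InG e × (InU1 p q e ⊎ InL2 p q e)

CharOrder : ℕ × ℕ → ℕ × ℕ → Set
CharOrder (a₁ , b₁) (a₂ , b₂) = b₁ ≤ b₂ × (b₁ ≡ b₂ → a₁ ≤ a₂)

IsCharList : (p q a b : ℕ) → List (ℕ × ℕ) → Set
IsCharList p q a b ps =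
  (∀ e → e ∈ ps → BestApprox p q e × proj₁ e ≤ a × proj₂ e ≤ b) ×
  (∀ e → BestApprox p q e → proj₁ e ≤ a → proj₂ e ≤ b → e ∈ ps) ×
  Unique ps × Linked CharOrder ps

T : (ps : List (ℕ × ℕ)) → Vec ℕ (length ps) → ℕ × ℕ
T [] [] = 0 , 0
T ((c , d) ∷ ps) (x ∷ xs) = x * c + proj₁ (T ps xs) , x * d + proj₂ (T ps xs)

InV : (ps : List (ℕ × ℕ)) → (a b : ℕ) → Vec ℕ (length ps) → Set
InV ps a b x = T ps x ≡ (a , b)

-- A_x : x₁ copies of entry 1, then x₂ copies of entry 2, ...
-- (an entry (c , d) stands for the factor p^c / q^d)
Ax : (ps : List (ℕ × ℕ)) → Vec ℕ (length ps) → List (ℕ × ℕ)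
Ax [] [] = []
Ax (e ∷ ps) (x ∷ xs) = replicate x e ++ Ax ps xs

-- A tuple F = ((c₁,d₁),…,(c_N,d_N)), standing for (p^c₁/q^d₁, …, p^c_N/q^d_N),
-- is a factorization of α = p^a/q^b: every factor ≠ 1, gcd(r_m , s_n) = 1
-- for all m n, and the product equals α (cross-multiplied in ℕ).
IsFactorization : (p q a b : ℕ) → List (ℕ × ℕ) → Set
IsFactorization p q a b F =
  All (λ e → ¬ (p ^ proj₁ e ≡ q ^ proj₂ e)) F ×
  All (λ e → All (λ e' → Coprime (p ^ proj₁ e) (q ^ proj₂ e')) F) F ×
  product (map (λ e → p ^ proj₁ e) F) * q ^ b ≡ p ^ a * product (map (λ e → q ^ proj₂ e) F)

-- representatives of elements of ℬ(α)
InB : (p q a b : ℕ) → List (ℕ × ℕ) → Set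
InB p q a b F = IsFactorization p q a b F × All (BestApprox p q) F

{-# OPTIONS --safe #-}
-- Since p and q are distinct primes, p^c/q^d determines (c , d), and a tuple of such
-- factors multiplies to p^a/q^b exactly when its exponent pairs add up to (a , b); the
-- coprimality conditions then hold automatically. A factor of such a tuple is bounded by
-- (a , b) componentwise, so if it is a best approximation it occurs in the characteristic
-- list. Hence ℬ(α) consists of the multisets over that list with exponent sum (a , b),
-- and x ↦ A_x just lists a multiset by multiplicities.
module Submission where

open import Defs
open import Data.Nat using (ℕ; zero; suc; _+_; _*_; _^_; _≤_; _<_; _≟_; z<s; >-nonZero; nonTrivial⇒n>1)
open import Data.Nat.Properties
open import Data.Nat.Divisibility using (_∣_; ∣-refl; ∣-trans; m∣m*n; ∣1⇒≡1)
open import Data.Nat.Coprimality using (Coprime; coprime-divisor; prime⇒coprime)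
import Data.Nat.Coprimality as Coprime
open import Data.Nat.Primality using (Prime; prime⇒nonZero; prime⇒nonTrivial)
open import Data.Nat.ListAction using (sum; product)
open import Data.Nat.ListAction.Properties using (sum-↭)
open import Data.Product using (Σ; _×_; _,_; proj₁; proj₂)
open import Data.Product.Properties using (≡-dec)
open import Data.List using (List; []; _∷_; _++_; length; replicate; map; filter)
open import Data.List.Properties using (++-identityʳ; filter-++; filter-all; filter-none; length-replicate)
open import Data.List.Membership.Propositional using (_∈_)
open import Data.List.Membership.Propositional.Properties using (∈-map⁺)
open import Data.List.Relation.Unary.Any using (here; there)
open import Data.List.Relation.Unary.All using (All; []; _∷_; tabulate; lookup)
import Data.List.Relation.Unary.All as All
open import Data.List.Relation.Unary.All.Properties using (++⁺; replicate⁺; all-filter; filter⁺)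
open import Data.List.Relation.Unary.AllPairs using (_∷_)
open import Data.List.Relation.Unary.Unique.Propositional using (Unique)
open import Data.List.Relation.Binary.Permutation.Propositional using (_↭_; refl; prep; trans; ↭-sym)
open import Data.List.Relation.Binary.Permutation.Propositional.Properties using (map⁺; shift; ++⁺ˡ; filter-↭; ↭-length)
open import Data.Vec using (Vec; []; _∷_)
open import Data.Empty using (⊥-elim)
open import Relation.Nullary using (yes; no)
open import Relation.Unary using (Decidable)
open import Relation.Unary.Properties using (∁?)
open import Relation.Binary.Definitions using (DecidableEquality; tri<; tri≈; tri>)
open import Relation.Binary.PropositionalEquality
  using (_≡_; _≢_; refl; cong; cong₂; sym; subst; subst₂; module ≡-Reasoning) renaming (trans to ≡-trans)

open ≡-Reasoning

coprime-*ʳ : ∀ {m n o} → Coprime m n → Coprime m o → Coprime m (n * o)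
coprime-*ʳ {n = n} m⊥n m⊥o (i∣m , i∣no) = m⊥o (i∣m , coprime-divisor i⊥n i∣no)
  where
  i⊥n : Coprime _ n
  i⊥n (j∣i , j∣n) = m⊥n (∣-trans j∣i i∣m , j∣n)

coprime-^ʳ : ∀ {m n} → Coprime m n → ∀ d → Coprime m (n ^ d)
coprime-^ʳ m⊥n zero    (_ , i∣1) = ∣1⇒≡1 i∣1
coprime-^ʳ m⊥n (suc d) = coprime-*ʳ m⊥n (coprime-^ʳ m⊥n d)

coprime-^ : ∀ {m n} → Coprime m n → ∀ c d → Coprime (m ^ c) (n ^ d)
coprime-^ m⊥n c d = Coprime.sym (coprime-^ʳ (Coprime.sym (coprime-^ʳ m⊥n d)) c)

^-injectiveʳ : ∀ {m} → 1 < m → ∀ {b c} → m ^ b ≡ m ^ c → b ≡ c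
^-injectiveʳ {m} 1<m {b} {c} eq with <-cmp b c
... | tri< b<c _ _ = ⊥-elim (<⇒≢ (^-monoʳ-< m 1<m b<c) eq)
... | tri≈ _ b≡c _ = b≡c
... | tri> _ _ b>c = ⊥-elim (<⇒≢ (^-monoʳ-< m 1<m b>c) (sym eq))

module CoprimeBases {x y : ℕ} (1<x : 1 < x) (1<y : 1 < y) (x⊥y : Coprime x y) where

  y^b≢x*k : ∀ b k → y ^ b ≢ x * k
  y^b≢x*k b k eq = <⇒≢ 1<x (sym (coprime-^ʳ x⊥y b (∣-refl , subst (x ∣_) (sym eq) (m∣m*n k))))

  ^*^-injective : ∀ a b c d → x ^ a * y ^ b ≡ x ^ c * y ^ d → a ≡ c × b ≡ d
  ^*^-injective zero b zero d eq =
    refl , ^-injectiveʳ 1<y (≡-trans (sym (*-identityˡ _)) (≡-trans eq (*-identityˡ _)))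
  ^*^-injective zero b (suc c) d eq = ⊥-elim (y^b≢x*k b (x ^ c * y ^ d) (begin
    y ^ b                ≡⟨ sym (*-identityˡ _) ⟩
    1 * y ^ b            ≡⟨ eq ⟩
    x * x ^ c * y ^ d    ≡⟨ *-assoc x _ _ ⟩
    x * (x ^ c * y ^ d)  ∎))
  ^*^-injective (suc a) b zero d eq = ⊥-elim (y^b≢x*k d (x ^ a * y ^ b) (begin
    y ^ d                ≡⟨ sym (*-identityˡ _) ⟩
    1 * y ^ d            ≡⟨ sym eq ⟩
    x * x ^ a * y ^ b    ≡⟨ *-assoc x _ _ ⟩
    x * (x ^ a * y ^ b)  ∎))
  ^*^-injective (suc a) b (suc c) d eq =
    let a≡c , b≡d = ^*^-injective a b c d (*-cancelˡ-≡ _ _ x {{>-nonZero (<-trans z<s 1<x)}} (begin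
          x * (x ^ a * y ^ b)  ≡⟨ sym (*-assoc x _ _) ⟩
          x * x ^ a * y ^ b    ≡⟨ eq ⟩
          x * x ^ c * y ^ d    ≡⟨ *-assoc x _ _ ⟩
          x * (x ^ c * y ^ d)  ∎))
    in cong suc a≡c , b≡d

  x^c≢y^d : ∀ {c d} → InN (c , d) → x ^ c ≢ y ^ d
  x^c≢y^d {c} {d} c,d≢0 eq =
    let c≡0 , 0≡d = ^*^-injective c 0 0 d (≡-trans (*-identityʳ _) (≡-trans eq (sym (*-identityˡ _))))
    in c,d≢0 (c≡0 , sym 0≡d)

∈⇒≤sum : ∀ {n ns} → n ∈ ns → n ≤ sum ns
∈⇒≤sum {ns = n ∷ _}  (here refl) = m≤m+n n _
∈⇒≤sum {ns = m ∷ _}  (there n∈ns) = m≤n⇒m≤o+n m (∈⇒≤sum n∈ns)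

product-map-^ : ∀ {A : Set} m (f : A → ℕ) xs → product (map (λ z → m ^ f z) xs) ≡ m ^ sum (map f xs)
product-map-^ m f []       = refl
product-map-^ m f (z ∷ xs) = ≡-trans (cong (m ^ f z *_) (product-map-^ m f xs)) (sym (^-distribˡ-+-* m (f z) _))

sum-map-replicate-++ : ∀ {A : Set} (f : A → ℕ) k z xs →
  sum (map f (replicate k z ++ xs)) ≡ k * f z + sum (map f xs)
sum-map-replicate-++ f zero    z xs = refl
sum-map-replicate-++ f (suc k) z xs =
  ≡-trans (cong (f z +_) (sum-map-replicate-++ f k z xs)) (sym (+-assoc (f z) _ _))

exponents : List (ℕ × ℕ) → ℕ × ℕ
exponents F = sum (map proj₁ F) , sum (map proj₂ F)

∈⇒≤exponents : ∀ {e F} → e ∈ F → proj₁ e ≤ proj₁ (exponents F) × proj₂ e ≤ proj₂ (exponents F)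
∈⇒≤exponents e∈F = ∈⇒≤sum (∈-map⁺ proj₁ e∈F) , ∈⇒≤sum (∈-map⁺ proj₂ e∈F)

exponents-↭ : ∀ {F G} → F ↭ G → exponents F ≡ exponents G
exponents-↭ F↭G = cong₂ _,_ (sum-↭ (map⁺ proj₁ F↭G)) (sum-↭ (map⁺ proj₂ F↭G))

T≡exponents∘Ax : ∀ ps x → T ps x ≡ exponents (Ax ps x)
T≡exponents∘Ax []             []       = refl
T≡exponents∘Ax ((c , d) ∷ ps) (k ∷ xs) rewrite T≡exponents∘Ax ps xs =
  cong₂ _,_ (sym (sum-map-replicate-++ proj₁ k (c , d) (Ax ps xs)))
            (sym (sum-map-replicate-++ proj₂ k (c , d) (Ax ps xs)))

module Factorization {p q : ℕ} (1<p : 1 < p) (1<q : 1 < q) (p⊥q : Coprime p q) where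

  open CoprimeBases 1<p 1<q p⊥q

  product-equation : ∀ a b F →
    product (map (λ e → p ^ proj₁ e) F) * q ^ b ≡ p ^ a * product (map (λ e → q ^ proj₂ e) F) →
    p ^ sum (map proj₁ F) * q ^ b ≡ p ^ a * q ^ sum (map proj₂ F)
  product-equation a b F eq = begin
    p ^ sum (map proj₁ F) * q ^ b                   ≡⟨ cong (_* q ^ b) (sym (product-map-^ p proj₁ F)) ⟩
    product (map (λ e → p ^ proj₁ e) F) * q ^ b     ≡⟨ eq ⟩
    p ^ a * product (map (λ e → q ^ proj₂ e) F)     ≡⟨ cong (p ^ a *_) (product-map-^ q proj₂ F) ⟩
    p ^ a * q ^ sum (map proj₂ F)                   ∎

  factorization⇒exponents : ∀ a b F → IsFactorization p q a b F → exponents F ≡ (a , b)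
  factorization⇒exponents a b F (_ , _ , eq) =
    let Σ₁≡a , b≡Σ₂ = ^*^-injective _ b a _ (product-equation a b F eq)
    in cong₂ _,_ Σ₁≡a (sym b≡Σ₂)

  exponents⇒factorization : ∀ a b F → All InN F → exponents F ≡ (a , b) → IsFactorization p q a b F
  exponents⇒factorization a b F F≢0 refl =
    All.map x^c≢y^d F≢0 ,
    tabulate (λ {e} _ → tabulate (λ {e'} _ → coprime-^ p⊥q (proj₁ e) (proj₂ e'))) ,
    (begin
      product (map (λ e → p ^ proj₁ e) F) * q ^ b   ≡⟨ cong (_* q ^ b) (product-map-^ p proj₁ F) ⟩
      p ^ a * q ^ b                                 ≡⟨ cong (p ^ a *_) (sym (product-map-^ q proj₂ F)) ⟩
      p ^ a * product (map (λ e → q ^ proj₂ e) F)   ∎)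

infix 4 _≟²_
_≟²_ : DecidableEquality (ℕ × ℕ)
_≟²_ = ≡-dec _≟_ _≟_

↭-filter-++-filter∁ : ∀ {A : Set} {P : A → Set} (P? : Decidable P) xs →
  xs ↭ filter P? xs ++ filter (∁? P?) xs
↭-filter-++-filter∁ P? []       = refl
↭-filter-++-filter∁ P? (z ∷ xs) with P? z
... | yes _ = prep z (↭-filter-++-filter∁ P? xs)
... | no  _ = trans (prep z (↭-filter-++-filter∁ P? xs)) (↭-sym (shift z _ _))

All-≡⇒≡replicate : ∀ {A : Set} {z : A} {xs} → All (_≡ z) xs → xs ≡ replicate (length xs) z
All-≡⇒≡replicate []           = refl
All-≡⇒≡replicate (refl ∷ z≡s) = cong (_ ∷_) (All-≡⇒≡replicate z≡s)

module _ {A : Set} (_≟ₐ_ : DecidableEquality A) (z : A) {xs : List A} (z∉xs : All (_≢ z) xs) where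

  filter-≡-replicate-++ : ∀ k → filter (_≟ₐ z) (replicate k z ++ xs) ≡ replicate k z
  filter-≡-replicate-++ k = begin
    filter (_≟ₐ z) (replicate k z ++ xs)                          ≡⟨ filter-++ (_≟ₐ z) (replicate k z) xs ⟩
    filter (_≟ₐ z) (replicate k z) ++ filter (_≟ₐ z) xs           ≡⟨ cong₂ _++_ (filter-all (_≟ₐ z) (replicate⁺ k refl))
                                                                               (filter-none (_≟ₐ z) z∉xs) ⟩
    replicate k z ++ []                                           ≡⟨ ++-identityʳ _ ⟩
    replicate k z                                                 ∎

  filter-≢-replicate-++ : ∀ k → filter (∁? (_≟ₐ z)) (replicate k z ++ xs) ≡ xs
  filter-≢-replicate-++ k = begin
    filter (∁? (_≟ₐ z)) (replicate k z ++ xs)                     ≡⟨ filter-++ (∁? (_≟ₐ z)) (replicate k z) xs ⟩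
    filter (∁? (_≟ₐ z)) (replicate k z) ++ filter (∁? (_≟ₐ z)) xs ≡⟨ cong₂ _++_ (filter-none (∁? (_≟ₐ z)) (replicate⁺ k (λ z≢z → z≢z refl)))
                                                                               (filter-all (∁? (_≟ₐ z)) z∉xs) ⟩
    xs                                                            ∎

Ax-∈ : ∀ ps x → All (_∈ ps) (Ax ps x)
Ax-∈ []       []       = []
Ax-∈ (e ∷ ps) (k ∷ xs) = ++⁺ (replicate⁺ k (here refl)) (All.map there (Ax-∈ ps xs))

Ax-injective : ∀ ps → Unique ps → ∀ x y → Ax ps x ↭ Ax ps y → x ≡ y
Ax-injective []       _              []       []       _  = refl
Ax-injective (e ∷ ps) (e∉ps ∷ ps-uq) (k ∷ xs) (l ∷ ys) Ax↭ = cong₂ _∷_ k≡l (Ax-injective ps ps-uq xs ys Axs↭)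
  where
  e∉Ax : ∀ zs → All (_≢ e) (Ax ps zs)
  e∉Ax zs = All.map (λ z∈ps z≡e → lookup e∉ps z∈ps (sym z≡e)) (Ax-∈ ps zs)

  k≡l : k ≡ l
  k≡l = begin
    k                                                   ≡⟨ sym (length-replicate k) ⟩
    length (replicate k e)                              ≡⟨ cong length (sym (filter-≡-replicate-++ _≟²_ e (e∉Ax xs) k)) ⟩
    length (filter (_≟² e) (Ax (e ∷ ps) (k ∷ xs)))      ≡⟨ ↭-length (filter-↭ (_≟² e) Ax↭) ⟩
    length (filter (_≟² e) (Ax (e ∷ ps) (l ∷ ys)))      ≡⟨ cong length (filter-≡-replicate-++ _≟²_ e (e∉Ax ys) l) ⟩
    length (replicate l e)                              ≡⟨ length-replicate l ⟩
    l                                                   ∎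

  Axs↭ : Ax ps xs ↭ Ax ps ys
  Axs↭ = subst₂ _↭_ (filter-≢-replicate-++ _≟²_ e (e∉Ax xs) k) (filter-≢-replicate-++ _≟²_ e (e∉Ax ys) l)
                    (filter-↭ (∁? (_≟² e)) Ax↭)

Ax-surjective : ∀ ps F → All (_∈ ps) F → Σ (Vec ℕ (length ps)) (λ x → Ax ps x ↭ F)
Ax-surjective []       []      _           = [] , refl
Ax-surjective []       (_ ∷ _) (() ∷ _)
Ax-surjective (e ∷ ps) F       F⊆e∷ps =
  let xs , Axs↭F≢ = Ax-surjective ps F≢ F≢⊆ps
  in length F₌ ∷ xs , trans (++⁺ˡ (replicate (length F₌) e) Axs↭F≢) F₌++F≢↭F
  where
  F₌ F≢ : List (ℕ × ℕ)
  F₌ = filter (_≟² e) F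
  F≢ = filter (∁? (_≟² e)) F

  F₌++F≢↭F : replicate (length F₌) e ++ F≢ ↭ F
  F₌++F≢↭F = subst (λ G → G ++ F≢ ↭ F) (All-≡⇒≡replicate (all-filter (_≟² e) F))
                   (↭-sym (↭-filter-++-filter∁ (_≟² e) F))

  F≢⊆ps : All (_∈ ps) F≢
  F≢⊆ps = All.zipWith (λ { (here z≡e , z≢e) → ⊥-elim (z≢e z≡e) ; (there z∈ps , _) → z∈ps })
                        (filter⁺ (∁? (_≟² e)) F⊆e∷ps , all-filter (∁? (_≟² e)) F)

theorem4p1 : (p q a b : ℕ) → Prime p → Prime q → p < q →
    BestApprox p q (a , b) →
    (ps : List (ℕ × ℕ)) → IsCharList p q a b ps →
    ((x : Vec ℕ (length ps)) → InV ps a b x → InB p q a b (Ax ps x)) ×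
    ((x y : Vec ℕ (length ps)) → InV ps a b x → InV ps a b y →
      Ax ps x ↭ Ax ps y → x ≡ y) ×
    ((F : List (ℕ × ℕ)) → InB p q a b F →
      Σ (Vec ℕ (length ps)) (λ x → InV ps a b x × Ax ps x ↭ F))
theorem4p1 p q a b p-prime q-prime p<q _ ps (ps-sound , ps-complete , ps-unique , _) =
  well-defined , (λ x y _ _ → Ax-injective ps ps-unique x y) , surjective
  where
  1<p : 1 < p
  1<p = nonTrivial⇒n>1 p {{prime⇒nonTrivial p-prime}}

  p⊥q : Coprime p q
  p⊥q = Coprime.sym (prime⇒coprime q-prime {{prime⇒nonZero p-prime}} p<q)

  open Factorization 1<p (<-trans 1<p p<q) p⊥q

  well-defined : (x : Vec ℕ (length ps)) → InV ps a b x → InB p q a b (Ax ps x)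
  well-defined x Tx≡ab =
    let Ax-best = All.map (λ e∈ps → proj₁ (ps-sound _ e∈ps)) (Ax-∈ ps x)
    in exponents⇒factorization a b (Ax ps x) (All.map (λ e-best → proj₁ (proj₁ e-best)) Ax-best)
                                  (≡-trans (sym (T≡exponents∘Ax ps x)) Tx≡ab) ,
       Ax-best

  surjective : (F : List (ℕ × ℕ)) → InB p q a b F → Σ (Vec ℕ (length ps)) (λ x → InV ps a b x × Ax ps x ↭ F)
  surjective F (F-factorization , F-best) =
    let expF≡ab = factorization⇒exponents a b F F-factorization
        F⊆ps = tabulate (λ {e} e∈F →
          let e₁≤ , e₂≤ = ∈⇒≤exponents e∈F
          in ps-complete e (lookup F-best e∈F) (≤-trans e₁≤ (≤-reflexive (cong proj₁ expF≡ab)))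
                                              (≤-trans e₂≤ (≤-reflexive (cong proj₂ expF≡ab))))
        x , Ax↭F = Ax-surjective ps F F⊆ps
    in x , ≡-trans (T≡exponents∘Ax ps x) (≡-trans (exponents-↭ Ax↭F) expF≡ab) , Ax↭F
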